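{- Let $k,l$ be positive integers and $n=kl$. For $\mathbf{x}\in\mathbb{F}_2^n$ and $1\le i\le k$ write $\mathbf{x}^{(i)}=(x_{(i-1)l+1},\ldots,x_{il})\in\mathbb{F}_2^l$, so $\mathbf{x}=(\mathbf{x}^{(1)},\ldots,\mathbf{x}^{(k)})$. Let $g_1,\ldots,g_k$ be balanced $l$-variable Boolean functions and let $\mathscr{G}:\mathbb{F}_2^n\to\mathbb{F}_2^k$ be $\mathscr{G}(\mathbf{X})=(g_1(\mathbf{X}^{(1)}),\ldots,g_k(\mathbf{X}^{(k)}))$. Then for every $k$-variable Boolean function $f$ and every $\mathbf{u}\in\mathbb{F}_2^n$, $$W_{f\circ\mathscr{G}}(\mathbf{u})=\begin{cases} W_f(\mathbf{0}_k) & \text{if } \mathbf{u}=\mathbf{0}_n,\\ W_f(\mathbf{w}_{\mathbf{u}})\prod_{i\in\mathrm{supp}(\mathbf{w}_{\mathbf{u}})} W_{g_i}(\mathbf{u}^{(i)}) & \text{otherwise,}\end{cases}$$ where $\mathbf{w}_{\mathbf{u}}\in\mathbb{F}_2^k$ is the vector whose $i$-th coordinate is $1$ if and only if $\mathbf{u}^{(i)}\neq\mathbf{0}_l$.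
   Context: $\mathbb{F}_2=\{0,1\}$. For $\mathbf{x},\mathbf{y}\in\mathbb{F}_2^m$, $\langle\mathbf{x},\mathbf{y}\rangle=x_1y_1\oplus\cdots\oplus x_my_m$, and $\mathrm{supp}(\mathbf{x})=\{i:x_i=1\}$. An $m$-variable Boolean function is a map $\mathbb{F}_2^m\to\mathbb{F}_2$; it is balanced if it takes the value $1$ on exactly $2^{m-1}$ inputs. The (normalised) Walsh transform of an $m$-variable Boolean function $f$ is $W_f(\boldsymbol{\alpha})=2^{ -m}\sum_{\mathbf{x}\in\mathbb{F}_2^m}(-1)^{f(\mathbf{x})\oplus\langle\mathbf{x},\boldsymbol{\alpha}\rangle}$ for $\boldsymbol{\alpha}\in\mathbb{F}_2^m$. The composition $f\circ\mathscr{G}$ is the $n$-variable Boolean function $\mathbf{X}\mapsto f(g_1(\mathbf{X}^{(1)}),\ldots,g_k(\mathbf{X}^{(k)}))$. -}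

module Defs where

open import Data.Bool using (Bool; true; false; _xor_; _∧_; not; if_then_else_)
open import Data.Nat as ℕ using (ℕ; zero; suc; _^_; _∸_)
open import Data.Nat.Properties using (m^n≢0)
open import Data.Integer as ℤ using (ℤ; +_; -[1+_])
open import Data.Rational as ℚ using (ℚ; 1ℚ; _*_)
open import Data.Fin using (Fin; combine)
open import Data.Vec using (Vec; []; _∷_; lookup; tabulate; replicate; zipWith; foldr)
open import Data.List as List using (List; []; _∷_; _++_; map; filter; length; allFin)
open import Relation.Nullary using (¬_)
open import Relation.Binary.PropositionalEquality using (_≡_; _≢_)
open import Data.Bool.Properties using () renaming (_≟_ to _≟B_)

-- F₂ is modelled by Bool (false = 0, true = 1, xor = addition).
-- An m-variable Boolean function
BoolFun : ℕ → Set
BoolFun m = Vec Bool m → Bool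

allVecs : (m : ℕ) → List (Vec Bool m)
allVecs zero = [] ∷ []
allVecs (suc m) = map (false ∷_) (allVecs m) ++ map (true ∷_) (allVecs m)

⟨_,_⟩ : ∀ {m} → Vec Bool m → Vec Bool m → Bool
⟨ x , y ⟩ = foldr _ _xor_ false (zipWith _∧_ x y)

Balanced : ∀ {m} → BoolFun m → Set
Balanced {m} g = length (filter (λ x → g x ≟B true) (allVecs m)) ≡ 2 ^ (m ∸ 1)

sgn : Bool → ℤ
sgn false = + 1
sgn true  = -[1+ 0 ]

sumℤ : List ℤ → ℤ
sumℤ = List.foldr ℤ._+_ (+ 0)

W : ∀ {m} → BoolFun m → Vec Bool m → ℚ
W {m} f α = ℚ._/_ (sumℤ (map (λ x → sgn (f x xor ⟨ x , α ⟩)) (allVecs m))) (2 ^ m) {{m^n≢0 2 m}}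

prodℚ : List ℚ → ℚ
prodℚ = List.foldr _*_ 1ℚ

-- the i-th block x^(i) = (x_{(i-1)l+1}, …, x_{il}) of x ∈ F₂^{kl}
-- (Data.Fin.combine i j = i * l + j, 0-indexed)
block : ∀ {k l} → Vec Bool (k ℕ.* l) → Fin k → Vec Bool l
block x i = tabulate (λ j → lookup x (combine i j))

𝟎 : ∀ m → Vec Bool m
𝟎 m = replicate m false

𝒢 : ∀ {k l} → (Fin k → BoolFun l) → Vec Bool (k ℕ.* l) → Vec Bool k
𝒢 g X = tabulate (λ i → g i (block X i))

_∘𝒢_ : ∀ {k l} → BoolFun k → (Fin k → BoolFun l) → BoolFun (k ℕ.* l)
(f ∘𝒢 g) X = f (𝒢 g X)

isZero : ∀ {m} → Vec Bool m → Bool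
isZero [] = true
isZero (false ∷ v) = isZero v
isZero (true ∷ v) = false

w : ∀ {k l} → Vec Bool (k ℕ.* l) → Vec Bool k
w {k} {l} u = tabulate (λ i → not (isZero (block {k} {l} u i)))

supp : ∀ {m} → Vec Bool m → List (Fin m)
supp {m} x = filter (λ i → lookup x i ≟B true) (allFin m)

{-# OPTIONS --safe #-}
-- Group the sum defining W_{f∘𝒢}(u) by the value y = 𝒢(X). The character (-1)^⟨X,u⟩ summed
-- over the fibre 𝒢⁻¹(y) factors over the blocks as ∏ᵢ cᵢ(yᵢ), where
-- cᵢ(b) = Σ_{gᵢ(x) = b} (-1)^⟨x,u⁽ⁱ⁾⟩. Expanding [gᵢ(x) = b] = (1 + (-1)^(b ⊕ gᵢ(x)))/2 gives
-- 2cᵢ(b) = Σ_x (-1)^⟨x,u⁽ⁱ⁾⟩ + (-1)^b 2^l W_{gᵢ}(u⁽ⁱ⁾): the first sum vanishes when u⁽ⁱ⁾ ≠ 0 and the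
-- second when u⁽ⁱ⁾ = 0, because gᵢ is balanced. So 2cᵢ(b) = (-1)^(b wᵢ) Kᵢ, where Kᵢ is
-- 2^l W_{gᵢ}(u⁽ⁱ⁾) if u⁽ⁱ⁾ ≠ 0 and 2^l otherwise (cᵢ is fibreSum, Kᵢ is blockFactor); the product
-- becomes (-1)^⟨y,w_u⟩ ∏ᵢ Kᵢ, and the remaining sum over y is 2^k W_f(w_u).
-- Everything is proved for the unnormalised sums over ℤ and divided out only at the end.
module Submission where

open import Defs
open import Data.Bool using (Bool; true; false; _xor_; _∧_; not; if_then_else_)
open import Data.Bool.Properties using (xor-assoc; xor-identityʳ; ∧-zeroʳ; ∧-identityʳ) renaming (_≟_ to _≟B_)
open import Data.Fin using (Fin; zero; suc; combine)
open import Data.Integer using (ℤ; +_; _+_; -_; _-_) renaming (_*_ to _*ℤ_)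
import Data.Integer.Properties as ℤP
open import Data.Integer.Tactic.RingSolver using (solve-∀)
open import Data.List as List using (List; []; _∷_; _++_; map; filter; allFin)
import Data.List.Properties as ListP
open import Data.List.Relation.Unary.All.Properties using (tabulate⁺)
open import Data.Nat as ℕ using (ℕ; zero; suc; _*_; _^_; _≥_; NonZero)
import Data.Nat.Properties as ℕP
open import Data.Product using (_×_; _,_)
open import Data.Rational using (ℚ; 1ℚ; _/_; toℚᵘ) renaming (_*_ to _*ℚ_)
import Data.Rational.Properties as ℚP
open import Data.Rational.Unnormalised using (mkℚᵘ; *≡*) renaming (_*_ to _*ᵘ_)
import Data.Rational.Unnormalised.Properties as ℚᵘP
open import Data.Vec as Vec using (Vec; []; _∷_; lookup; tabulate)
open import Data.Vec.Properties using (tabulate-cong; tabulate∘lookup; lookup∘tabulate; lookup-++ˡ; lookup-++ʳ; lookup-replicate)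
open import Relation.Binary.PropositionalEquality using (_≡_; _≢_; refl; sym; trans; cong; cong₂; module ≡-Reasoning)
open import Algebra.Properties.CommutativeSemigroup ℤP.*-commutativeSemigroup using (x∙yz≈y∙xz; x∙yz≈z∙xy)
open import Algebra.Properties.CommutativeMonoid.Sum ℤP.*-1-commutativeMonoid
  using (sum-cong-≗) renaming (sum to ∏; ∑-distrib-+ to ∏-distrib-*ℤ)

/-cross : ∀ a b m n .{{_ : NonZero m}} .{{_ : NonZero n}} → a *ℤ + n ≡ b *ℤ + m → a / m ≡ b / n
/-cross a b (suc m) (suc n) eq = ℚP.fromℚᵘ-cong {mkℚᵘ a m} {mkℚᵘ b n} (*≡* eq)

/-*-/ : ∀ a b m n .{{_ : NonZero m}} .{{_ : NonZero n}} →
        (a / m) *ℚ (b / n) ≡ ((a *ℤ b) / (m * n)) {{ℕP.m*n≢0 m n}}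
/-*-/ a b (suc m) (suc n) = ℚP.toℚᵘ-injective (begin-equality
  toℚᵘ ((a / suc m) *ℚ (b / suc n))        ≃⟨ ℚP.toℚᵘ-homo-* (a / suc m) (b / suc n) ⟩
  toℚᵘ (a / suc m) *ᵘ toℚᵘ (b / suc n)      ≃⟨ ℚᵘP.*-cong (ℚP.toℚᵘ-fromℚᵘ (mkℚᵘ a m)) (ℚP.toℚᵘ-fromℚᵘ (mkℚᵘ b n)) ⟩
  mkℚᵘ a m *ᵘ mkℚᵘ b n                     ≃⟨ ℚP.toℚᵘ-fromℚᵘ (mkℚᵘ a m *ᵘ mkℚᵘ b n) ⟨
  toℚᵘ ((a *ℤ b) / (suc m * suc n)) ∎)
  where open ℚᵘP.≤-Reasoning

open ≡-Reasoning

∑ : ∀ {A : Set} → List A → (A → ℤ) → ℤ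
∑ xs φ = sumℤ (map φ xs)

∑-cong : ∀ {A : Set} (xs : List A) {φ ψ : A → ℤ} → (∀ x → φ x ≡ ψ x) → ∑ xs φ ≡ ∑ xs ψ
∑-cong []       e = refl
∑-cong (x ∷ xs) e = cong₂ _+_ (e x) (∑-cong xs e)

∑-++ : ∀ {A : Set} (xs ys : List A) φ → ∑ (xs ++ ys) φ ≡ ∑ xs φ + ∑ ys φ
∑-++ []       ys φ = sym (ℤP.+-identityˡ _)
∑-++ (x ∷ xs) ys φ = trans (cong (_+_ (φ x)) (∑-++ xs ys φ)) (sym (ℤP.+-assoc (φ x) _ _))

∑-map : ∀ {A B : Set} (h : A → B) (xs : List A) φ → ∑ (map h xs) φ ≡ ∑ xs (λ x → φ (h x))
∑-map h []       φ = refl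
∑-map h (x ∷ xs) φ = cong (_+_ (φ (h x))) (∑-map h xs φ)

∑-*ˡ : ∀ {A : Set} (xs : List A) c φ → ∑ xs (λ x → c *ℤ φ x) ≡ c *ℤ ∑ xs φ
∑-*ˡ []       c φ = sym (ℤP.*-zeroʳ c)
∑-*ˡ (x ∷ xs) c φ = trans (cong (_+_ (c *ℤ φ x)) (∑-*ˡ xs c φ)) (sym (ℤP.*-distribˡ-+ c (φ x) _))

∑-+ : ∀ {A : Set} (xs : List A) φ ψ → ∑ xs (λ x → φ x + ψ x) ≡ ∑ xs φ + ∑ xs ψ
∑-+ []       φ ψ = refl
∑-+ (x ∷ xs) φ ψ = trans (cong (_+_ (φ x + ψ x)) (∑-+ xs φ ψ)) (interchange (φ x) (ψ x) _ _)
  where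
  interchange : ∀ a b c d → a + b + (c + d) ≡ a + c + (b + d)
  interchange = solve-∀

∑ᵛ : ∀ m → (Vec Bool m → ℤ) → ℤ
∑ᵛ m = ∑ (allVecs m)

∑ᵛ-suc : ∀ m φ → ∑ᵛ (suc m) φ ≡ ∑ᵛ m (λ x → φ (false ∷ x)) + ∑ᵛ m (λ x → φ (true ∷ x))
∑ᵛ-suc m φ = trans (∑-++ (map (false ∷_) (allVecs m)) _ φ)
  (cong₂ _+_ (∑-map (false ∷_) (allVecs m) φ) (∑-map (true ∷_) (allVecs m) φ))

∑ᵛ-++ : ∀ a b φ → ∑ᵛ (a ℕ.+ b) φ ≡ ∑ᵛ a (λ x → ∑ᵛ b (λ y → φ (x Vec.++ y)))
∑ᵛ-++ zero    b φ = sym (ℤP.+-identityʳ _)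
∑ᵛ-++ (suc a) b φ = begin
  ∑ᵛ (suc a ℕ.+ b) φ
    ≡⟨ ∑ᵛ-suc (a ℕ.+ b) φ ⟩
  ∑ᵛ (a ℕ.+ b) (λ z → φ (false ∷ z)) + ∑ᵛ (a ℕ.+ b) (λ z → φ (true ∷ z))
    ≡⟨ cong₂ _+_ (∑ᵛ-++ a b (λ z → φ (false ∷ z))) (∑ᵛ-++ a b (λ z → φ (true ∷ z))) ⟩
  ∑ᵛ a (λ x → ∑ᵛ b (λ y → φ (false ∷ x Vec.++ y))) + ∑ᵛ a (λ x → ∑ᵛ b (λ y → φ (true ∷ x Vec.++ y)))
    ≡⟨ ∑ᵛ-suc a _ ⟨
  ∑ᵛ (suc a) (λ x → ∑ᵛ b (λ y → φ (x Vec.++ y))) ∎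

length-allVecs : ∀ m → List.length (allVecs m) ≡ 2 ^ m
length-allVecs zero    = refl
length-allVecs (suc m) = begin
  List.length (map (false ∷_) (allVecs m) ++ map (true ∷_) (allVecs m))
    ≡⟨ ListP.length-++ (map (false ∷_) (allVecs m)) ⟩
  List.length (map (false ∷_) (allVecs m)) ℕ.+ List.length (map (true ∷_) (allVecs m))
    ≡⟨ cong₂ ℕ._+_ (trans (ListP.length-map _ (allVecs m)) (length-allVecs m))
                   (trans (ListP.length-map _ (allVecs m)) (length-allVecs m)) ⟩
  2 ^ m ℕ.+ 2 ^ m
    ≡⟨ cong (2 ^ m ℕ.+_) (ℕP.+-identityʳ (2 ^ m)) ⟨
  2 ^ suc m ∎

sgn-xor : ∀ a b → sgn (a xor b) ≡ sgn a *ℤ sgn b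
sgn-xor false b     = sym (ℤP.*-identityˡ (sgn b))
sgn-xor true  false = refl
sgn-xor true  true  = refl

sgn-not : ∀ a → sgn (not a) ≡ - + 1 *ℤ sgn a
sgn-not false = refl
sgn-not true  = refl

⟨⟩-++ : ∀ {a b} (x u : Vec Bool a) (y v : Vec Bool b) → ⟨ x Vec.++ y , u Vec.++ v ⟩ ≡ ⟨ x , u ⟩ xor ⟨ y , v ⟩
⟨⟩-++ []      []      y v = refl
⟨⟩-++ (a ∷ x) (c ∷ u) y v = trans (cong ((a ∧ c) xor_) (⟨⟩-++ x u y v)) (sym (xor-assoc (a ∧ c) _ _))

⟨-,𝟎⟩≡false : ∀ {m} (x : Vec Bool m) → ⟨ x , 𝟎 m ⟩ ≡ false
⟨-,𝟎⟩≡false []      = refl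
⟨-,𝟎⟩≡false (a ∷ x) = trans (cong (_xor ⟨ x , 𝟎 _ ⟩) (∧-zeroʳ a)) (⟨-,𝟎⟩≡false x)

isZero⇒≡𝟎 : ∀ {m} (v : Vec Bool m) → isZero v ≡ true → v ≡ 𝟎 m
isZero⇒≡𝟎 []          _  = refl
isZero⇒≡𝟎 (false ∷ v) eq = cong (false ∷_) (isZero⇒≡𝟎 v eq)

χ : ∀ {m} → Vec Bool m → Vec Bool m → ℤ
χ v x = sgn ⟨ x , v ⟩

∑ᵛ-χ : ∀ m (v : Vec Bool m) → ∑ᵛ m (χ v) ≡ (if isZero v then + (2 ^ m) else + 0)
∑ᵛ-χ zero    []          = refl
∑ᵛ-χ (suc m) (false ∷ v) = begin
  ∑ᵛ (suc m) (χ (false ∷ v))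
    ≡⟨ ∑ᵛ-suc m (χ (false ∷ v)) ⟩
  ∑ᵛ m (χ v) + ∑ᵛ m (χ v)
    ≡⟨ cong₂ _+_ (∑ᵛ-χ m v) (∑ᵛ-χ m v) ⟩
  (if isZero v then + (2 ^ m) else + 0) + (if isZero v then + (2 ^ m) else + 0)
    ≡⟨ double (isZero v) ⟩
  (if isZero v then + (2 ^ suc m) else + 0) ∎
  where
  double : ∀ z → (if z then + (2 ^ m) else + 0) + (if z then + (2 ^ m) else + 0) ≡ (if z then + (2 ^ suc m) else + 0)
  double false = refl
  double true  = cong +_ (cong (2 ^ m ℕ.+_) (sym (ℕP.+-identityʳ (2 ^ m))))
∑ᵛ-χ (suc m) (true ∷ v)  = begin
  ∑ᵛ (suc m) (χ (true ∷ v))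
    ≡⟨ ∑ᵛ-suc m (χ (true ∷ v)) ⟩
  ∑ᵛ m (χ v) + ∑ᵛ m (λ x → sgn (not ⟨ x , v ⟩))
    ≡⟨ cong (_+_ (∑ᵛ m (χ v))) (trans (∑-cong (allVecs m) (λ x → sgn-not ⟨ x , v ⟩)) (∑-*ˡ (allVecs m) (- + 1) (χ v))) ⟩
  ∑ᵛ m (χ v) + - + 1 *ℤ ∑ᵛ m (χ v)
    ≡⟨ cancel (∑ᵛ m (χ v)) ⟩
  + 0 ∎
  where
  cancel : ∀ e → e + - + 1 *ℤ e ≡ + 0
  cancel = solve-∀

walshSum : ∀ {m} → BoolFun m → Vec Bool m → ℤ
walshSum {m} f α = ∑ᵛ m (λ x → sgn (f x xor ⟨ x , α ⟩))

∑-sgn-count : ∀ {A : Set} (h : A → Bool) (xs : List A) →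
  ∑ xs (λ x → sgn (h x)) ≡ + List.length xs - + 2 *ℤ + List.length (filter (λ x → h x ≟B true) xs)
∑-sgn-count h []       = refl
∑-sgn-count h (x ∷ xs) with h x
... | false = trans (cong (_+_ (+ 1)) (∑-sgn-count h xs))
                    (shift (+ List.length xs) (+ List.length (filter (λ x → h x ≟B true) xs)))
  where
  shift : ∀ n c → + 1 + (n - + 2 *ℤ c) ≡ + 1 + n - + 2 *ℤ c
  shift = solve-∀
... | true  = trans (cong (_+_ (- + 1)) (∑-sgn-count h xs))
                    (shift (+ List.length xs) (+ List.length (filter (λ x → h x ≟B true) xs)))
  where
  shift : ∀ n c → - + 1 + (n - + 2 *ℤ c) ≡ + 1 + n - + 2 *ℤ (+ 1 + c)
  shift = solve-∀

-- For l = 0 the only balanced function is the constant 1, whose sum is -1.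
balanced⇒walshSum-𝟎≡0 : ∀ {l} → l ≥ 1 → (h : BoolFun l) → Balanced h → walshSum h (𝟎 l) ≡ + 0
balanced⇒walshSum-𝟎≡0 {suc l} _ h bal = begin
  walshSum h (𝟎 (suc l))
    ≡⟨ ∑-cong (allVecs (suc l)) (λ x → cong (λ b → sgn (h x xor b)) (⟨-,𝟎⟩≡false x)) ⟩
  ∑ᵛ (suc l) (λ x → sgn (h x xor false))
    ≡⟨ ∑-cong (allVecs (suc l)) (λ x → cong sgn (xor-identityʳ (h x))) ⟩
  ∑ᵛ (suc l) (λ x → sgn (h x))
    ≡⟨ ∑-sgn-count h (allVecs (suc l)) ⟩
  + List.length (allVecs (suc l)) - + 2 *ℤ + List.length (filter (λ x → h x ≟B true) (allVecs (suc l)))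
    ≡⟨ cong₂ (λ n c → + n - + 2 *ℤ + c) (length-allVecs (suc l)) bal ⟩
  + (2 * 2 ^ l) - + 2 *ℤ + (2 ^ l)
    ≡⟨ cong (_- + 2 *ℤ + (2 ^ l)) (ℤP.pos-* 2 (2 ^ l)) ⟩
  + 2 *ℤ + (2 ^ l) - + 2 *ℤ + (2 ^ l)
    ≡⟨ ℤP.+-inverseʳ (+ 2 *ℤ + (2 ^ l)) ⟩
  + 0 ∎

δ : Bool → Bool → ℤ
δ true  true  = + 1
δ false false = + 1
δ _     _     = + 0

∑-fibres : ∀ {A : Set} (xs : List A) (h : A → Bool) (H : Bool → ℤ) (φ : A → ℤ) →
  ∑ xs (λ x → φ x *ℤ H (h x))
    ≡ ∑ xs (λ x → δ (h x) false *ℤ φ x) *ℤ H false + ∑ xs (λ x → δ (h x) true *ℤ φ x) *ℤ H true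
∑-fibres xs h H φ = begin
  ∑ xs (λ x → φ x *ℤ H (h x))
    ≡⟨ ∑-cong xs (λ x → split (h x) (φ x)) ⟩
  ∑ xs (λ x → H false *ℤ (δ (h x) false *ℤ φ x) + H true *ℤ (δ (h x) true *ℤ φ x))
    ≡⟨ ∑-+ xs _ _ ⟩
  ∑ xs (λ x → H false *ℤ (δ (h x) false *ℤ φ x)) + ∑ xs (λ x → H true *ℤ (δ (h x) true *ℤ φ x))
    ≡⟨ cong₂ _+_ (trans (∑-*ˡ xs (H false) _) (ℤP.*-comm (H false) _))
                 (trans (∑-*ˡ xs (H true) _) (ℤP.*-comm (H true) _)) ⟩
  ∑ xs (λ x → δ (h x) false *ℤ φ x) *ℤ H false + ∑ xs (λ x → δ (h x) true *ℤ φ x) *ℤ H true ∎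
  where
  split : ∀ a s → s *ℤ H a ≡ H false *ℤ (δ a false *ℤ s) + H true *ℤ (δ a true *ℤ s)
  split false s = keep-left (H false) (H true) s
    where
    keep-left : ∀ p q s → s *ℤ p ≡ p *ℤ (+ 1 *ℤ s) + q *ℤ (+ 0 *ℤ s)
    keep-left = solve-∀
  split true s = keep-right (H false) (H true) s
    where
    keep-right : ∀ p q s → s *ℤ q ≡ p *ℤ (+ 0 *ℤ s) + q *ℤ (+ 1 *ℤ s)
    keep-right = solve-∀

fibreSum : ∀ {l} → BoolFun l → Vec Bool l → Bool → ℤ
fibreSum {l} h v b = ∑ᵛ l (λ x → δ (h x) b *ℤ χ v x)

blockFactor : ∀ {l} → BoolFun l → Vec Bool l → ℤ
blockFactor {l} h v = if isZero v then + (2 ^ l) else walshSum h v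

δ-sgn : ∀ a b e → + 2 *ℤ (δ a b *ℤ sgn e) ≡ sgn e + sgn b *ℤ sgn (a xor e)
δ-sgn false false false = refl
δ-sgn false false true  = refl
δ-sgn false true  false = refl
δ-sgn false true  true  = refl
δ-sgn true  false false = refl
δ-sgn true  false true  = refl
δ-sgn true  true  false = refl
δ-sgn true  true  true  = refl

+2*fibreSum : ∀ {l} (h : BoolFun l) (v : Vec Bool l) (b : Bool) →
  + 2 *ℤ fibreSum h v b ≡ ∑ᵛ l (χ v) + sgn b *ℤ walshSum h v
+2*fibreSum {l} h v b = begin
  + 2 *ℤ fibreSum h v b
    ≡⟨ ∑-*ˡ (allVecs l) (+ 2) _ ⟨
  ∑ᵛ l (λ x → + 2 *ℤ (δ (h x) b *ℤ χ v x))
    ≡⟨ ∑-cong (allVecs l) (λ x → δ-sgn (h x) b ⟨ x , v ⟩) ⟩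
  ∑ᵛ l (λ x → χ v x + sgn b *ℤ sgn (h x xor ⟨ x , v ⟩))
    ≡⟨ ∑-+ (allVecs l) _ _ ⟩
  ∑ᵛ l (χ v) + ∑ᵛ l (λ x → sgn b *ℤ sgn (h x xor ⟨ x , v ⟩))
    ≡⟨ cong (_+_ (∑ᵛ l (χ v))) (∑-*ˡ (allVecs l) (sgn b) _) ⟩
  ∑ᵛ l (χ v) + sgn b *ℤ walshSum h v ∎

+2*fibreSum-balanced : ∀ {l} → l ≥ 1 → (h : BoolFun l) → Balanced h → (v : Vec Bool l) (b : Bool) →
  + 2 *ℤ fibreSum h v b ≡ sgn (b ∧ not (isZero v)) *ℤ blockFactor h v
+2*fibreSum-balanced {l} l≥1 h bal v b with isZero v in eq
... | false = begin
  + 2 *ℤ fibreSum h v b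
    ≡⟨ +2*fibreSum h v b ⟩
  ∑ᵛ l (χ v) + sgn b *ℤ walshSum h v
    ≡⟨ cong (_+ sgn b *ℤ walshSum h v) (trans (∑ᵛ-χ l v) (cong (if_then + (2 ^ l) else + 0) eq)) ⟩
  + 0 + sgn b *ℤ walshSum h v
    ≡⟨ ℤP.+-identityˡ _ ⟩
  sgn b *ℤ walshSum h v
    ≡⟨ cong (λ c → sgn c *ℤ walshSum h v) (∧-identityʳ b) ⟨
  sgn (b ∧ true) *ℤ walshSum h v ∎
... | true = begin
  + 2 *ℤ fibreSum h v b
    ≡⟨ +2*fibreSum h v b ⟩
  ∑ᵛ l (χ v) + sgn b *ℤ walshSum h v
    ≡⟨ cong₂ (λ s t → s + sgn b *ℤ t) (trans (∑ᵛ-χ l v) (cong (if_then + (2 ^ l) else + 0) eq))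
             (trans (cong (walshSum h) (isZero⇒≡𝟎 v eq)) (balanced⇒walshSum-𝟎≡0 l≥1 h bal)) ⟩
  + (2 ^ l) + sgn b *ℤ + 0
    ≡⟨ drop-zero (sgn b) (+ (2 ^ l)) ⟩
  sgn false *ℤ + (2 ^ l)
    ≡⟨ cong (λ c → sgn c *ℤ + (2 ^ l)) (∧-zeroʳ b) ⟨
  sgn (b ∧ false) *ℤ + (2 ^ l) ∎
  where
  drop-zero : ∀ s a → a + s *ℤ + 0 ≡ + 1 *ℤ a
  drop-zero = solve-∀

block-++-zero : ∀ {k l} (x : Vec Bool l) (y : Vec Bool (k * l)) → block {suc k} {l} (x Vec.++ y) zero ≡ x
block-++-zero x y = trans (tabulate-cong (lookup-++ˡ x y)) (tabulate∘lookup x)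

block-++-suc : ∀ {k l} (x : Vec Bool l) (y : Vec Bool (k * l)) i →
  block {suc k} {l} (x Vec.++ y) (suc i) ≡ block {k} {l} y i
block-++-suc x y i = tabulate-cong (λ j → lookup-++ʳ x y (combine i j))

𝒢-++ : ∀ {k l} (g : Fin (suc k) → BoolFun l) (x : Vec Bool l) (y : Vec Bool (k * l)) →
  𝒢 {suc k} {l} g (x Vec.++ y) ≡ g zero x ∷ 𝒢 {k} {l} (λ i → g (suc i)) y
𝒢-++ {k} {l} g x y = cong₂ _∷_ (cong (g zero) (block-++-zero {k} {l} x y))
  (tabulate-cong (λ i → cong (g (suc i)) (block-++-suc {k} {l} x y i)))

fibreProduct : ∀ {k l} → (Fin k → BoolFun l) → Vec Bool (k * l) → Vec Bool k → ℤ
fibreProduct {k} {l} g u y = ∏ (λ i → fibreSum (g i) (block {k} {l} u i) (lookup y i))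

fibreProduct-++ : ∀ {k l} (g : Fin (suc k) → BoolFun l) (u₀ : Vec Bool l) (U : Vec Bool (k * l)) b y →
  fibreProduct {suc k} {l} g (u₀ Vec.++ U) (b ∷ y) ≡ fibreSum (g zero) u₀ b *ℤ fibreProduct {k} {l} (λ i → g (suc i)) U y
fibreProduct-++ {k} {l} g u₀ U b y = cong₂ _*ℤ_
  (cong (λ v → fibreSum (g zero) v b) (block-++-zero {k} {l} u₀ U))
  (sum-cong-≗ (λ i → cong (λ v → fibreSum (g (suc i)) v (lookup y i)) (block-++-suc {k} {l} u₀ U i)))

χ-𝒢-++ : ∀ {k l} (g : Fin (suc k) → BoolFun l) (ψ : Vec Bool (suc k) → ℤ)
  (u₀ x : Vec Bool l) (U Y : Vec Bool (k * l)) →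
  ψ (𝒢 {suc k} {l} g (x Vec.++ Y)) *ℤ χ (u₀ Vec.++ U) (x Vec.++ Y)
    ≡ χ u₀ x *ℤ (ψ (g zero x ∷ 𝒢 {k} {l} (λ i → g (suc i)) Y) *ℤ χ U Y)
χ-𝒢-++ {k} {l} g ψ u₀ x U Y = trans
  (cong₂ (λ y s → ψ y *ℤ s) (𝒢-++ {k} {l} g x Y) (trans (cong sgn (⟨⟩-++ x u₀ Y U)) (sgn-xor ⟨ x , u₀ ⟩ ⟨ Y , U ⟩)))
  (x∙yz≈y∙xz (ψ (g zero x ∷ 𝒢 {k} {l} (λ i → g (suc i)) Y)) (χ u₀ x) (χ U Y))

∑-∘𝒢 : ∀ k {l} (g : Fin k → BoolFun l) (u : Vec Bool (k * l)) (ψ : Vec Bool k → ℤ) →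
  ∑ᵛ (k * l) (λ X → ψ (𝒢 {k} {l} g X) *ℤ χ u X) ≡ ∑ᵛ k (λ y → ψ y *ℤ fibreProduct {k} {l} g u y)
∑-∘𝒢 zero    g [] ψ = refl
∑-∘𝒢 (suc k) {l} g u ψ with Vec.splitAt l u
... | u₀ , U , refl = begin
  ∑ᵛ (l ℕ.+ k * l) (λ X → ψ (𝒢 {suc k} {l} g X) *ℤ χ (u₀ Vec.++ U) X)
    ≡⟨ ∑ᵛ-++ l (k * l) _ ⟩
  ∑ᵛ l (λ x → ∑ᵛ (k * l) (λ Y → ψ (𝒢 {suc k} {l} g (x Vec.++ Y)) *ℤ χ (u₀ Vec.++ U) (x Vec.++ Y)))
    ≡⟨ ∑-cong (allVecs l) (λ x → trans (∑-cong (allVecs (k * l)) (χ-𝒢-++ {k} {l} g ψ u₀ x U))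
                                       (∑-*ˡ (allVecs (k * l)) (χ u₀ x) _)) ⟩
  ∑ᵛ l (λ x → χ u₀ x *ℤ ∑ᵛ (k * l) (λ Y → ψ (g zero x ∷ 𝒢 {k} {l} g′ Y) *ℤ χ U Y))
    ≡⟨ ∑-cong (allVecs l) (λ x → cong (χ u₀ x *ℤ_) (∑-∘𝒢 k g′ U (λ y → ψ (g zero x ∷ y)))) ⟩
  ∑ᵛ l (λ x → χ u₀ x *ℤ H (g zero x))
    ≡⟨ ∑-fibres (allVecs l) (g zero) H (χ u₀) ⟩
  fibreSum (g zero) u₀ false *ℤ H false + fibreSum (g zero) u₀ true *ℤ H true
    ≡⟨ cong₂ _+_ (sum-with-head false) (sum-with-head true) ⟨
  ∑ᵛ k (λ y → ψ (false ∷ y) *ℤ P (false ∷ y)) + ∑ᵛ k (λ y → ψ (true ∷ y) *ℤ P (true ∷ y))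
    ≡⟨ ∑ᵛ-suc k _ ⟨
  ∑ᵛ (suc k) (λ y → ψ y *ℤ P y) ∎
  where
  g′ : Fin k → BoolFun l
  g′ i = g (suc i)
  P : Vec Bool (suc k) → ℤ
  P = fibreProduct {suc k} {l} g (u₀ Vec.++ U)
  H : Bool → ℤ
  H b = ∑ᵛ k (λ y → ψ (b ∷ y) *ℤ fibreProduct {k} {l} g′ U y)
  sum-with-head : ∀ b → ∑ᵛ k (λ y → ψ (b ∷ y) *ℤ P (b ∷ y)) ≡ fibreSum (g zero) u₀ b *ℤ H b
  sum-with-head b = trans
    (∑-cong (allVecs k) (λ y → trans (cong (ψ (b ∷ y) *ℤ_) (fibreProduct-++ {k} {l} g u₀ U b y))
                                     (x∙yz≈y∙xz (ψ (b ∷ y)) (fibreSum (g zero) u₀ b) _)))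
    (∑-*ˡ (allVecs k) (fibreSum (g zero) u₀ b) _)

∏-const : ∀ k n → ∏ {k} (λ _ → + n) ≡ + (n ^ k)
∏-const zero    n = refl
∏-const (suc k) n = trans (cong (+ n *ℤ_) (∏-const k n)) (sym (ℤP.pos-* n (n ^ k)))

∏-sgn-∧ : ∀ {k} (y v : Vec Bool k) → ∏ (λ i → sgn (lookup y i ∧ lookup v i)) ≡ sgn ⟨ y , v ⟩
∏-sgn-∧ []      []      = refl
∏-sgn-∧ (a ∷ y) (b ∷ v) = trans (cong (sgn (a ∧ b) *ℤ_) (∏-sgn-∧ y v)) (sym (sgn-xor (a ∧ b) ⟨ y , v ⟩))

+2^k*fibreProduct : ∀ k l → l ≥ 1 → (g : Fin k → BoolFun l) → (∀ i → Balanced (g i)) →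
  (u : Vec Bool (k * l)) (y : Vec Bool k) →
  + (2 ^ k) *ℤ fibreProduct {k} {l} g u y ≡ sgn ⟨ y , w {k} {l} u ⟩ *ℤ ∏ (λ i → blockFactor (g i) (block {k} {l} u i))
+2^k*fibreProduct k l l≥1 g bal u y = begin
  + (2 ^ k) *ℤ ∏ (λ i → c i)
    ≡⟨ cong (_*ℤ ∏ (λ i → c i)) (∏-const k 2) ⟨
  ∏ {k} (λ _ → + 2) *ℤ ∏ (λ i → c i)
    ≡⟨ ∏-distrib-*ℤ (λ _ → + 2) (λ i → c i) ⟨
  ∏ (λ i → + 2 *ℤ c i)
    ≡⟨ sum-cong-≗ (λ i → +2*fibreSum-balanced l≥1 (g i) (bal i) (u⁽ i ⁾) (lookup y i)) ⟩
  ∏ (λ i → sgn (lookup y i ∧ not (isZero (u⁽ i ⁾))) *ℤ K i)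
    ≡⟨ ∏-distrib-*ℤ (λ i → sgn (lookup y i ∧ not (isZero (u⁽ i ⁾)))) K ⟩
  ∏ (λ i → sgn (lookup y i ∧ not (isZero (u⁽ i ⁾)))) *ℤ ∏ K
    ≡⟨ cong (_*ℤ ∏ K) signs ⟩
  sgn ⟨ y , w {k} {l} u ⟩ *ℤ ∏ K ∎
  where
  u⁽_⁾ : Fin k → Vec Bool l
  u⁽ i ⁾ = block {k} {l} u i
  c K : Fin k → ℤ
  c i = fibreSum (g i) (u⁽ i ⁾) (lookup y i)
  K i = blockFactor (g i) (u⁽ i ⁾)
  signs : ∏ (λ i → sgn (lookup y i ∧ not (isZero (u⁽ i ⁾)))) ≡ sgn ⟨ y , w {k} {l} u ⟩
  signs = trans (sum-cong-≗ (λ i → cong (λ b → sgn (lookup y i ∧ b)) (sym (lookup∘tabulate _ i))))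
                (∏-sgn-∧ y (w {k} {l} u))

walshSum-∘𝒢 : ∀ k l → l ≥ 1 → (g : Fin k → BoolFun l) → (∀ i → Balanced (g i)) →
  (f : BoolFun k) (u : Vec Bool (k * l)) →
  + (2 ^ k) *ℤ walshSum (f ∘𝒢 g) u ≡ ∏ (λ i → blockFactor (g i) (block {k} {l} u i)) *ℤ walshSum f (w {k} {l} u)
walshSum-∘𝒢 k l l≥1 g bal f u = begin
  + (2 ^ k) *ℤ walshSum (f ∘𝒢 g) u
    ≡⟨ cong (+ (2 ^ k) *ℤ_) (∑-cong (allVecs (k * l)) (λ X → sgn-xor (f (𝒢 {k} {l} g X)) ⟨ X , u ⟩)) ⟩
  + (2 ^ k) *ℤ ∑ᵛ (k * l) (λ X → sgn (f (𝒢 {k} {l} g X)) *ℤ χ u X)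
    ≡⟨ cong (+ (2 ^ k) *ℤ_) (∑-∘𝒢 k g u (λ y → sgn (f y))) ⟩
  + (2 ^ k) *ℤ ∑ᵛ k (λ y → sgn (f y) *ℤ fibreProduct {k} {l} g u y)
    ≡⟨ ∑-*ˡ (allVecs k) (+ (2 ^ k)) _ ⟨
  ∑ᵛ k (λ y → + (2 ^ k) *ℤ (sgn (f y) *ℤ fibreProduct {k} {l} g u y))
    ≡⟨ ∑-cong (allVecs k) pointwise ⟩
  ∑ᵛ k (λ y → K *ℤ sgn (f y xor ⟨ y , w {k} {l} u ⟩))
    ≡⟨ ∑-*ˡ (allVecs k) K _ ⟩
  K *ℤ walshSum f (w {k} {l} u) ∎
  where
  K : ℤ
  K = ∏ (λ i → blockFactor (g i) (block {k} {l} u i))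
  pointwise : ∀ y → + (2 ^ k) *ℤ (sgn (f y) *ℤ fibreProduct {k} {l} g u y) ≡ K *ℤ sgn (f y xor ⟨ y , w {k} {l} u ⟩)
  pointwise y = begin
    + (2 ^ k) *ℤ (sgn (f y) *ℤ fibreProduct {k} {l} g u y)
      ≡⟨ x∙yz≈y∙xz (+ (2 ^ k)) (sgn (f y)) _ ⟩
    sgn (f y) *ℤ (+ (2 ^ k) *ℤ fibreProduct {k} {l} g u y)
      ≡⟨ cong (sgn (f y) *ℤ_) (+2^k*fibreProduct k l l≥1 g bal u y) ⟩
    sgn (f y) *ℤ (sgn ⟨ y , w {k} {l} u ⟩ *ℤ K)
      ≡⟨ x∙yz≈z∙xy (sgn (f y)) (sgn ⟨ y , w {k} {l} u ⟩) K ⟩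
    K *ℤ (sgn (f y) *ℤ sgn ⟨ y , w {k} {l} u ⟩)
      ≡⟨ cong (K *ℤ_) (sgn-xor (f y) ⟨ y , w {k} {l} u ⟩) ⟨
    K *ℤ sgn (f y xor ⟨ y , w {k} {l} u ⟩) ∎

prodℚ-filter : ∀ {A : Set} (p : A → Bool) (h : A → ℚ) (xs : List A) →
  prodℚ (map h (filter (λ x → p x ≟B true) xs)) ≡ prodℚ (map (λ x → if p x then h x else 1ℚ) xs)
prodℚ-filter p h []       = refl
prodℚ-filter p h (x ∷ xs) with p x
... | true  = cong (h x *ℚ_) (prodℚ-filter p h xs)
... | false = trans (prodℚ-filter p h xs) (sym (ℚP.*-identityˡ _))

prodℚ-tabulate-/ : ∀ k (K : Fin k → ℤ) d .{{_ : NonZero d}} →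
  prodℚ (List.tabulate (λ i → K i / d)) ≡ (∏ K / d ^ k) {{ℕP.m^n≢0 d k}}
prodℚ-tabulate-/ zero    K d = refl
prodℚ-tabulate-/ (suc k) K d = trans (cong (K zero / d *ℚ_) (prodℚ-tabulate-/ k (λ i → K (suc i)) d))
  (/-*-/ (K zero) (∏ (λ i → K (suc i))) d (d ^ k) {{_}} {{ℕP.m^n≢0 d k}})

isZero-𝟎 : ∀ m → isZero (𝟎 m) ≡ true
isZero-𝟎 zero    = refl
isZero-𝟎 (suc m) = isZero-𝟎 m

block-𝟎 : ∀ {k l} (i : Fin k) → block {k} {l} (𝟎 (k * l)) i ≡ 𝟎 l
block-𝟎 {k} {l} i = trans
  (tabulate-cong (λ j → trans (lookup-replicate (combine i j) false) (sym (lookup-replicate j false))))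
  (tabulate∘lookup (𝟎 l))

w-𝟎 : ∀ {k l} → w {k} {l} (𝟎 (k * l)) ≡ 𝟎 k
w-𝟎 {k} {l} = trans
  (tabulate-cong (λ i → trans (cong (λ v → not (isZero v)) (block-𝟎 {k} {l} i))
                              (trans (cong not (isZero-𝟎 l)) (sym (lookup-replicate i false)))))
  (tabulate∘lookup (𝟎 k))

supp-𝟎 : ∀ m → supp (𝟎 m) ≡ []
supp-𝟎 m = ListP.filter-none (λ i → lookup (𝟎 m) i ≟B true)
  (tabulate⁺ {f = λ i → i} (λ i eq → false≢true (trans (sym (lookup-replicate i false)) eq)))
  where
  false≢true : false ≢ true
  false≢true ()

module _ (k l : ℕ) where
  private instance
    2^l≢0 : NonZero (2 ^ l)
    2^l≢0 = ℕP.m^n≢0 2 l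
    2^kl≢0 : NonZero (2 ^ (k * l))
    2^kl≢0 = ℕP.m^n≢0 2 (k * l)
    2^k≢0 : NonZero (2 ^ k)
    2^k≢0 = ℕP.m^n≢0 2 k
    2^k*2^kl≢0 : NonZero (2 ^ k * 2 ^ (k * l))
    2^k*2^kl≢0 = ℕP.m*n≢0 (2 ^ k) (2 ^ (k * l))

  if-not-/2^l : ∀ z (S : ℤ) → (if not z then S / 2 ^ l else 1ℚ) ≡ (if z then + (2 ^ l) else S) / 2 ^ l
  if-not-/2^l false S = refl
  if-not-/2^l true  S = /-cross (+ 1) (+ (2 ^ l)) 1 (2 ^ l) (trans (ℤP.*-identityˡ _) (sym (ℤP.*-identityʳ _)))

  prodℚ-supp-w : ∀ (g : Fin k → BoolFun l) (u : Vec Bool (k * l)) →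
    prodℚ (map (λ i → W (g i) (block {k} {l} u i)) (supp (w {k} {l} u)))
      ≡ ∏ (λ i → blockFactor (g i) (block {k} {l} u i)) / 2 ^ (k * l)
  prodℚ-supp-w g u = begin
    prodℚ (map h (supp (w {k} {l} u)))
      ≡⟨ prodℚ-filter (lookup (w {k} {l} u)) h (allFin k) ⟩
    prodℚ (map h′ (allFin k))
      ≡⟨ cong prodℚ (ListP.map-tabulate (λ i → i) h′) ⟩
    prodℚ (List.tabulate h′)
      ≡⟨ cong prodℚ (ListP.tabulate-cong (λ i → trans (cong (λ c → if c then h i else 1ℚ) (lookup∘tabulate _ i))
                                                       (if-not-/2^l (isZero (u⁽ i ⁾)) (walshSum (g i) (u⁽ i ⁾))))) ⟩
    prodℚ (List.tabulate (λ i → K i / 2 ^ l))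
      ≡⟨ prodℚ-tabulate-/ k K (2 ^ l) ⟩
    (∏ K / (2 ^ l) ^ k) {{ℕP.m^n≢0 (2 ^ l) k}}
      ≡⟨ ℚP./-cong {∏ K} {{ℕP.m^n≢0 (2 ^ l) k}} refl (trans (ℕP.^-*-assoc 2 l k) (cong (2 ^_) (ℕP.*-comm l k))) ⟩
    ∏ K / 2 ^ (k * l) ∎
    where
    u⁽_⁾ : Fin k → Vec Bool l
    u⁽ i ⁾ = block {k} {l} u i
    h h′ : Fin k → ℚ
    h i = W (g i) (u⁽ i ⁾)
    h′ i = if lookup (w {k} {l} u) i then h i else 1ℚ
    K : Fin k → ℤ
    K i = blockFactor (g i) (u⁽ i ⁾)

  W-∘𝒢 : l ≥ 1 → (g : Fin k → BoolFun l) → (∀ i → Balanced (g i)) → (f : BoolFun k) (u : Vec Bool (k * l)) →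
    W (f ∘𝒢 g) u ≡ W f (w {k} {l} u) *ℚ prodℚ (map (λ i → W (g i) (block {k} {l} u i)) (supp (w {k} {l} u)))
  W-∘𝒢 l≥1 g bal f u = begin
    W (f ∘𝒢 g) u
      ≡⟨ /-cross T (S *ℤ K) (2 ^ (k * l)) (2 ^ k * 2 ^ (k * l)) cross-multiplied ⟩
    (S *ℤ K) / (2 ^ k * 2 ^ (k * l))
      ≡⟨ /-*-/ S K (2 ^ k) (2 ^ (k * l)) ⟨
    W f (w {k} {l} u) *ℚ (K / 2 ^ (k * l))
      ≡⟨ cong (W f (w {k} {l} u) *ℚ_) (prodℚ-supp-w g u) ⟨
    W f (w {k} {l} u) *ℚ prodℚ (map (λ i → W (g i) (block {k} {l} u i)) (supp (w {k} {l} u))) ∎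
    where
    T S K : ℤ
    T = walshSum (f ∘𝒢 g) u
    S = walshSum f (w {k} {l} u)
    K = ∏ (λ i → blockFactor (g i) (block {k} {l} u i))
    cross-multiplied : T *ℤ + (2 ^ k * 2 ^ (k * l)) ≡ S *ℤ K *ℤ + (2 ^ (k * l))
    cross-multiplied = begin
      T *ℤ + (2 ^ k * 2 ^ (k * l))
        ≡⟨ cong (T *ℤ_) (ℤP.pos-* (2 ^ k) (2 ^ (k * l))) ⟩
      T *ℤ (+ (2 ^ k) *ℤ + (2 ^ (k * l)))
        ≡⟨ ℤP.*-assoc T (+ (2 ^ k)) _ ⟨
      T *ℤ + (2 ^ k) *ℤ + (2 ^ (k * l))
        ≡⟨ cong (_*ℤ + (2 ^ (k * l))) (trans (ℤP.*-comm T (+ (2 ^ k))) (walshSum-∘𝒢 k l l≥1 g bal f u)) ⟩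
      K *ℤ S *ℤ + (2 ^ (k * l))
        ≡⟨ cong (_*ℤ + (2 ^ (k * l))) (ℤP.*-comm K S) ⟩
      S *ℤ K *ℤ + (2 ^ (k * l)) ∎

  W-∘𝒢-𝟎 : l ≥ 1 → (g : Fin k → BoolFun l) → (∀ i → Balanced (g i)) → (f : BoolFun k) →
    W (f ∘𝒢 g) (𝟎 (k * l)) ≡ W f (𝟎 k)
  W-∘𝒢-𝟎 l≥1 g bal f = begin
    W (f ∘𝒢 g) (𝟎 (k * l))
      ≡⟨ W-∘𝒢 l≥1 g bal f (𝟎 (k * l)) ⟩
    W f (w {k} {l} (𝟎 (k * l))) *ℚ prodℚ (map h (supp (w {k} {l} (𝟎 (k * l)))))
      ≡⟨ cong (λ v → W f v *ℚ prodℚ (map h (supp v))) (w-𝟎 {k} {l}) ⟩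
    W f (𝟎 k) *ℚ prodℚ (map h (supp (𝟎 k)))
      ≡⟨ cong (λ is → W f (𝟎 k) *ℚ prodℚ (map h is)) (supp-𝟎 k) ⟩
    W f (𝟎 k) *ℚ 1ℚ
      ≡⟨ ℚP.*-identityʳ (W f (𝟎 k)) ⟩
    W f (𝟎 k) ∎
    where
    h : Fin k → ℚ
    h i = W (g i) (block {k} {l} (𝟎 (k * l)) i)

theorem3 : (k l : ℕ) → k ≥ 1 → l ≥ 1 →
    (g : Fin k → BoolFun l) → (∀ i → Balanced (g i)) →
    (f : BoolFun k) → (u : Vec Bool (k * l)) →
    (u ≡ 𝟎 (k * l) → W (f ∘𝒢 g) u ≡ W f (𝟎 k)) ×
    (u ≢ 𝟎 (k * l) →
      W (f ∘𝒢 g) u ≡ W f (w {k} {l} u) *ℚ prodℚ (map (λ i → W (g i) (block {k} {l} u i)) (supp (w {k} {l} u))))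
theorem3 k l _ l≥1 g bal f u = (λ { refl → W-∘𝒢-𝟎 k l l≥1 g bal f }) , (λ _ → W-∘𝒢 k l l≥1 g bal f u)
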